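{- Let $n\ge 0$. Two independent random walks each start at the origin and take $n$ steps, each step being N $(0,+1)$ or E $(+1,0)$ with probability $1/2$ each, independently. The probability that the two walks have no common vertex other than the origin is $\binom{2n}{n}/4^n$. -}

module Defs where

open import Data.Bool using (Bool; true; false)
open import Data.Nat using (ℕ; zero; suc; _+_; _^_; NonZero)
open import Data.Nat.Properties as ℕP using (m^n≢0)
open import Data.Product using (_×_; _,_; uncurry)
open import Data.Product.Properties using (≡-dec)
open import Data.Vec using (Vec; []; _∷_)
open import Data.List using (List; []; _∷_; [_]; map; length; filter; cartesianProduct; concatMap)
open import Data.List.Relation.Unary.All using (All; all?)
open import Relation.Nullary using (¬_; Dec; ¬?)
open import Relation.Binary.PropositionalEquality using (_≡_)
open import Relation.Binary.Definitions using (DecidableEquality)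
open import Data.Integer using (+_)
open import Data.Rational using (ℚ; _/_)

Point : Set
Point = ℕ × ℕ

_≟ₚ_ : DecidableEquality Point
_≟ₚ_ = ≡-dec ℕP._≟_ ℕP._≟_

open import Data.List.Membership.DecPropositional _≟ₚ_ using (_∈_; _∈?_) public

-- A walk of n steps: true = N step (0,+1), false = E step (+1,0).
Walk : ℕ → Set
Walk n = Vec Bool n

move : Bool → Point → Point
move true  (x , y) = x , suc y
move false (x , y) = suc x , y

vertsFrom : ∀ {n} → Point → Walk n → List Point
vertsFrom p []       = []
vertsFrom p (b ∷ bs) = move b p ∷ vertsFrom (move b p) bs

-- Vertices of the walk started at the origin, other than the origin itself
-- (the starting vertex; all later vertices differ from the origin anyway).
verts : ∀ {n} → Walk n → List Point
verts = vertsFrom (0 , 0)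

NoCommonVertex : ∀ {n} → Walk n → Walk n → Set
NoCommonVertex w₁ w₂ = All (λ v → ¬ (v ∈ verts w₂)) (verts w₁)

noCommonVertex? : ∀ {n} (w₁ w₂ : Walk n) → Dec (NoCommonVertex w₁ w₂)
noCommonVertex? w₁ w₂ = all? (λ v → ¬? (v ∈? verts w₂)) (verts w₁)

-- All 2^n walks of length n (each equally likely: independent fair steps).
allWalks : (n : ℕ) → List (Walk n)
allWalks zero    = [ [] ]
allWalks (suc n) = concatMap (λ w → (true ∷ w) ∷ (false ∷ w) ∷ []) (allWalks n)

allPairs : (n : ℕ) → List (Walk n × Walk n)
allPairs n = cartesianProduct (allWalks n) (allWalks n)

favourable : ℕ → ℕ
favourable n = length (filter (λ p → noCommonVertex? (Data.Product.proj₁ p) (Data.Product.proj₂ p)) (allPairs n))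

probNoCommonVertex : ℕ → ℚ
probNoCommonVertex n = (+ favourable n) / (4 ^ n)
  where instance _ = m^n≢0 4 n

-- Two walks started on a common antidiagonal x + y = const stay on common antidiagonals, so
-- they can only share a vertex at equal times; it therefore suffices to forbid meetings step by step.
-- Once the walks have separated, only the vertical gap g between them matters: each joint step
-- keeps g, raises it or lowers it, and the walks meet when g hits 0. The number of non-meeting
-- pairs of n-step walks from gap g is  Σ_{k<g} C(2n+1, n+1+k), which satisfies the same
-- recurrence (a double Pascal rule, with the reflection C(2n+1, n) = C(2n+1, n+1) at the
-- boundary). From the origin the first step must separate the walks, leaving gap 1 in either
-- orientation, which gives 2 C(2n-1, n) = C(2n, n) favourable pairs out of 4^n.
module Submission where

open import Data.Bool using (Bool; true; false; if_then_else_)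
open import Data.Integer using (+_)
open import Data.List using (List; []; _∷_; _++_; map; concatMap; cartesianProduct; length; filter)
open import Data.List.Relation.Unary.All as All using (All; []; _∷_; all?)
open import Data.List.Relation.Unary.Any using (here; there)
open import Data.Nat using (ℕ; zero; suc; _+_; _*_; _^_; _<_; s≤s)
open import Data.Nat.Combinatorics using (_C_; nCk+nC[k+1]≡[n+1]C[k+1]; nCk≡nC[n∸k]; k>n⇒nCk≡0)
open import Data.Nat.Properties
open import Algebra.Properties.CommutativeSemigroup +-commutativeSemigroup using (interchange)
open import Data.Nat.Tactic.RingSolver using (solve-∀)
open import Data.Product using (_×_; _,_; proj₁; proj₂)
open import Data.Rational using (_/_)
open import Data.Vec using ([]; _∷_)
open import Function using (_∘_)
open import Function.Bundles using (_⇔_; mk⇔)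
open import Relation.Binary.PropositionalEquality
open import Relation.Nullary using (¬_; Dec; yes; no; does; ¬?)
open import Relation.Nullary.Decidable using (dec-true; dec-false; does-⇔)
open import Relation.Unary using (Pred; Decidable)
open import Defs

open ≡-Reasoning

pascal₂ : ∀ m k → (2 + m) C (2 + k) ≡ m C k + 2 * (m C (1 + k)) + m C (2 + k)
pascal₂ m k = begin
  (2 + m) C (2 + k)
    ≡⟨ pascal (1 + m) (1 + k) ⟨
  (1 + m) C (1 + k) + (1 + m) C (2 + k)
    ≡⟨ cong₂ _+_ (pascal m k) (pascal m (1 + k)) ⟨
  (m C k + m C (1 + k)) + (m C (1 + k) + m C (2 + k))
    ≡⟨ regroup (m C k) (m C (1 + k)) (m C (2 + k)) ⟩
  m C k + 2 * (m C (1 + k)) + m C (2 + k) ∎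
  where
  pascal = nCk+nC[k+1]≡[n+1]C[k+1]
  regroup : ∀ a b c → (a + b) + (b + c) ≡ a + 2 * b + c
  regroup = solve-∀

-- C(2n+1, n+1+k), with row and column written so that k = 0 and k = suc j unfold without rewriting.
oddCentral : ℕ → ℕ → ℕ
oddCentral n k = (n + suc n) C (k + suc n)

oddCentral-reflect : ∀ n → (n + suc n) C n ≡ oddCentral n 0
oddCentral-reflect n =
  trans (nCk≡nC[n∸k] (m≤m+n n (suc n))) (cong ((n + suc n) C_) (m+n∸m≡n n (suc n)))

oddCentral-lower : ∀ n k → (n + suc n) C (suc k + n) ≡ oddCentral n k
oddCentral-lower n k = cong ((n + suc n) C_) (sym (+-suc k n))

oddCentral-suc : ∀ n k →
  oddCentral (suc n) k ≡ (n + suc n) C (k + n) + 2 * oddCentral n k + oddCentral n (suc k)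
oddCentral-suc n k = begin
  oddCentral (suc n) k
    ≡⟨ cong₂ _C_ (cong suc (+-suc n (suc n))) (trans (+-suc k (suc n)) (cong suc (+-suc k n))) ⟩
  (2 + m) C (2 + (k + n))
    ≡⟨ pascal₂ m (k + n) ⟩
  m C (k + n) + 2 * (m C suc (k + n)) + m C suc (suc (k + n))
    ≡⟨ cong (λ i → m C (k + n) + 2 * (m C i) + m C suc i) (+-suc k n) ⟨
  m C (k + n) + 2 * oddCentral n k + oddCentral n (suc k) ∎
  where m = n + suc n

oddCentralSum : ℕ → ℕ → ℕ
oddCentralSum n zero    = 0
oddCentralSum n (suc g) = oddCentralSum n g + oddCentral n g

oddCentralSum-zero : ∀ g → oddCentralSum 0 (suc g) ≡ 1
oddCentralSum-zero zero    = refl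
oddCentralSum-zero (suc g) = cong₂ _+_ (oddCentralSum-zero g) (k>n⇒nCk≡0 (s≤s (m≤n+m 1 g)))

oddCentralSum-suc : ∀ n g →
  oddCentralSum (suc n) (suc g) ≡
    oddCentralSum n g + 2 * oddCentralSum n (suc g) + oddCentralSum n (2 + g)
oddCentralSum-suc n zero = begin
  oddCentral (suc n) 0           ≡⟨ oddCentral-suc n 0 ⟩
  (n + suc n) C n + 2 * p₀ + p₁  ≡⟨ cong (λ a → a + 2 * p₀ + p₁) (oddCentral-reflect n) ⟩
  p₀ + 2 * p₀ + p₁               ≡⟨ regroup p₀ p₁ ⟩
  2 * p₀ + (p₀ + p₁)             ∎
  where
  p₀ = oddCentral n 0
  p₁ = oddCentral n 1
  regroup : ∀ a b → a + 2 * a + b ≡ 2 * a + (a + b)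
  regroup = solve-∀
oddCentralSum-suc n (suc g) = begin
  oddCentralSum (suc n) (suc g) + oddCentral (suc n) (suc g)
    ≡⟨ cong₂ _+_ (oddCentralSum-suc n g) (oddCentral-suc n (suc g)) ⟩
  (s + 2 * (s + p₀) + (s + p₀ + p₁)) + ((n + suc n) C (suc g + n) + 2 * p₁ + p₂)
    ≡⟨ cong (λ a → (s + 2 * (s + p₀) + (s + p₀ + p₁)) + (a + 2 * p₁ + p₂))
            (oddCentral-lower n g) ⟩
  (s + 2 * (s + p₀) + (s + p₀ + p₁)) + (p₀ + 2 * p₁ + p₂)
    ≡⟨ regroup s p₀ p₁ p₂ ⟩
  (s + p₀) + 2 * (s + p₀ + p₁) + (s + p₀ + p₁ + p₂) ∎
  where
  s  = oddCentralSum n g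
  p₀ = oddCentral n g
  p₁ = oddCentral n (1 + g)
  p₂ = oddCentral n (2 + g)
  regroup : ∀ s p₀ p₁ p₂ →
    (s + 2 * (s + p₀) + (s + p₀ + p₁)) + (p₀ + 2 * p₁ + p₂) ≡
    (s + p₀) + 2 * (s + p₀ + p₁) + (s + p₀ + p₁ + p₂)
  regroup = solve-∀

centralBinomial-suc : ∀ n → (2 * suc n) C suc n ≡ oddCentral n 0 + oddCentral n 0
centralBinomial-suc n = begin
  (2 * suc n) C suc n       ≡⟨ cong (λ i → suc (n + i) C suc n) (+-identityʳ (suc n)) ⟩
  suc m C suc n             ≡⟨ nCk+nC[k+1]≡[n+1]C[k+1] m n ⟨
  m C n + m C suc n         ≡⟨ cong (_+ m C suc n) (oddCentral-reflect n) ⟩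
  oddCentral n 0 + oddCentral n 0 ∎
  where m = n + suc n

private variable
  A B : Set

∑ : List A → (A → ℕ) → ℕ
∑ []       f = 0
∑ (x ∷ xs) f = f x + ∑ xs f

∑-cong : ∀ (xs : List A) {f g : A → ℕ} → (∀ x → f x ≡ g x) → ∑ xs f ≡ ∑ xs g
∑-cong []       f≗g = refl
∑-cong (x ∷ xs) f≗g = cong₂ _+_ (f≗g x) (∑-cong xs f≗g)

∑-zero : ∀ (xs : List A) → ∑ xs (λ _ → 0) ≡ 0
∑-zero []       = refl
∑-zero (x ∷ xs) = ∑-zero xs

∑-+ : ∀ (xs : List A) (f g : A → ℕ) → ∑ xs (λ x → f x + g x) ≡ ∑ xs f + ∑ xs g
∑-+ []       f g = refl
∑-+ (x ∷ xs) f g =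
  trans (cong (_+_ (f x + g x)) (∑-+ xs f g)) (interchange (f x) (g x) (∑ xs f) (∑ xs g))

∑-++ : ∀ (xs ys : List A) (f : A → ℕ) → ∑ (xs ++ ys) f ≡ ∑ xs f + ∑ ys f
∑-++ []       ys f = refl
∑-++ (x ∷ xs) ys f = trans (cong (_+_ (f x)) (∑-++ xs ys f)) (sym (+-assoc (f x) _ _))

∑-map : ∀ (h : A → B) xs (f : B → ℕ) → ∑ (map h xs) f ≡ ∑ xs (f ∘ h)
∑-map h []       f = refl
∑-map h (x ∷ xs) f = cong (_+_ (f (h x))) (∑-map h xs f)

∑-concatMap : ∀ (h : A → List B) xs (f : B → ℕ) →
  ∑ (concatMap h xs) f ≡ ∑ xs (λ x → ∑ (h x) f)
∑-concatMap h []       f = refl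
∑-concatMap h (x ∷ xs) f =
  trans (∑-++ (h x) (concatMap h xs) f) (cong (_+_ (∑ (h x) f)) (∑-concatMap h xs f))

∑-cartesianProduct : ∀ (xs : List A) (ys : List B) (f : A × B → ℕ) →
  ∑ (cartesianProduct xs ys) f ≡ ∑ xs (λ x → ∑ ys (λ y → f (x , y)))
∑-cartesianProduct []       ys f = refl
∑-cartesianProduct (x ∷ xs) ys f =
  trans (∑-++ (map (x ,_) ys) (cartesianProduct xs ys) f)
        (cong₂ _+_ (∑-map (x ,_) ys f) (∑-cartesianProduct xs ys f))

∑-comm : ∀ (xs : List A) (ys : List B) (f : A → B → ℕ) →
  ∑ xs (λ x → ∑ ys (f x)) ≡ ∑ ys (λ y → ∑ xs (λ x → f x y))
∑-comm []       ys f = sym (∑-zero ys)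
∑-comm (x ∷ xs) ys f =
  trans (cong (_+_ (∑ ys (f x))) (∑-comm xs ys f)) (sym (∑-+ ys (f x) _))

𝟙 : Bool → ℕ
𝟙 true  = 1
𝟙 false = 0

length-filter : ∀ {ℓ} {P : Pred A ℓ} (P? : Decidable P) xs →
  length (filter P? xs) ≡ ∑ xs (λ x → 𝟙 (does (P? x)))
length-filter P? [] = refl
length-filter P? (x ∷ xs) with does (P? x)
... | true  = cong suc (length-filter P? xs)
... | false = length-filter P? xs

∑-allWalks-suc : ∀ n (f : Walk (suc n) → ℕ) →
  ∑ (allWalks (suc n)) f ≡
    ∑ (allWalks n) (λ w → f (true ∷ w)) + ∑ (allWalks n) (λ w → f (false ∷ w))
∑-allWalks-suc n f = begin
  ∑ (allWalks (suc n)) f                          ≡⟨ ∑-concatMap _ (allWalks n) f ⟩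
  ∑ (allWalks n) (λ w → f (true ∷ w) + (f (false ∷ w) + 0))
    ≡⟨ ∑-cong (allWalks n) (λ w → cong (_+_ (f (true ∷ w))) (+-identityʳ _)) ⟩
  ∑ (allWalks n) (λ w → f (true ∷ w) + f (false ∷ w)) ≡⟨ ∑-+ (allWalks n) _ _ ⟩
  ∑ (allWalks n) (λ w → f (true ∷ w)) + ∑ (allWalks n) (λ w → f (false ∷ w)) ∎

opaque
  apart : Point → Point → ℕ → ℕ
  apart p q k = if does (p ≟ₚ q) then 0 else k

  apart-≡ : ∀ {p q k} → p ≡ q → apart p q k ≡ 0
  apart-≡ {p} {q} {k} p≡q = cong (if_then 0 else k) (dec-true (p ≟ₚ q) p≡q)

  apart-≢ : ∀ {p q k} → ¬ p ≡ q → apart p q k ≡ k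
  apart-≢ {p} {q} {k} p≢q = cong (if_then 0 else k) (dec-false (p ≟ₚ q) p≢q)

apart-comm : ∀ {p q k} → apart p q k ≡ apart q p k
apart-comm {p} {q} {k} = byCases (p ≟ₚ q)
  where
  byCases : Dec (p ≡ q) → apart p q k ≡ apart q p k
  byCases (yes p≡q) = trans (apart-≡ p≡q) (sym (apart-≡ (sym p≡q)))
  byCases (no  p≢q) = trans (apart-≢ p≢q) (sym (apart-≢ (p≢q ∘ sym)))

∑-apart : ∀ p q (xs : List A) (f : A → ℕ) →
  ∑ xs (λ x → apart p q (f x)) ≡ apart p q (∑ xs f)
∑-apart p q xs f = byCases (p ≟ₚ q)
  where
  byCases : Dec (p ≡ q) → ∑ xs (λ x → apart p q (f x)) ≡ apart p q (∑ xs f)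
  byCases (yes p≡q) =
    trans (∑-cong xs (λ _ → apart-≡ p≡q)) (trans (∑-zero xs) (sym (apart-≡ p≡q)))
  byCases (no  p≢q) = trans (∑-cong xs (λ _ → apart-≢ p≢q)) (sym (apart-≢ p≢q))

avoids : ∀ {n} → Point → Walk n → Point → Walk n → ℕ
avoids p []      q []      = 1
avoids p (b ∷ w) q (c ∷ v) = apart (move b p) (move c q) (avoids (move b p) w (move c q) v)

avoids-comm : ∀ {n} p (w : Walk n) q v → avoids p w q v ≡ avoids q v p w
avoids-comm p []      q []      = refl
avoids-comm p (b ∷ w) q (c ∷ v) =
  trans apart-comm (cong (apart (move c q) (move b p)) (avoids-comm (move b p) w (move c q) v))

level : Point → ℕ
level (x , y) = x + y

level-move : ∀ b p → level (move b p) ≡ suc (level p)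
level-move true  (x , y) = +-suc x y
level-move false (x , y) = refl

Above : ℕ → List Point → Set
Above l = All (λ v → l < level v)

vertsFrom-above : ∀ {n} p (w : Walk n) → Above (level p) (vertsFrom p w)
vertsFrom-above p []      = []
vertsFrom-above p (b ∷ w) = p<p′ ∷ All.map (<-trans p<p′) (vertsFrom-above (move b p) w)
  where
  p<p′ : level p < level (move b p)
  p<p′ = ≤-reflexive (sym (level-move b p))

Disjoint : List Point → List Point → Set
Disjoint xs ys = All (λ v → ¬ v ∈ ys) xs

disjoint? : ∀ xs ys → Dec (Disjoint xs ys)
disjoint? xs ys = all? (λ v → ¬? (v ∈? ys)) xs

disjoint-∷⇔ : ∀ {x y xs ys} →
  level x ≡ level y → Above (level x) xs → Above (level y) ys → ¬ x ≡ y →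
  Disjoint (x ∷ xs) (y ∷ ys) ⇔ Disjoint xs ys
disjoint-∷⇔ {x} {y} {xs} {ys} x~y xs-above ys-above x≢y = mk⇔
  (λ where (_ ∷ d) → All.map (λ v∉ → v∉ ∘ there) d)
  (λ d → x∉ ∷ All.zipWith v∉ (xs-above , d))
  where
  x∉ : ¬ x ∈ (y ∷ ys)
  x∉ (here x≡y)   = x≢y x≡y
  x∉ (there x∈ys) = <-irrefl (sym x~y) (All.lookup ys-above x∈ys)

  v∉ : ∀ {v} → level x < level v × ¬ v ∈ ys → ¬ v ∈ (y ∷ ys)
  v∉ (x<v , _)    (here refl)  = <-irrefl x~y x<v
  v∉ (_   , v∉ys) (there v∈ys) = v∉ys v∈ys

disjoint-∷ : ∀ {x y xs ys} →
  level x ≡ level y → Above (level x) xs → Above (level y) ys →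
  𝟙 (does (disjoint? (x ∷ xs) (y ∷ ys))) ≡ apart x y (𝟙 (does (disjoint? xs ys)))
disjoint-∷ {x} {y} {xs} {ys} x~y xs-above ys-above = byCases (x ≟ₚ y)
  where
  byCases : Dec (x ≡ y) →
    𝟙 (does (disjoint? (x ∷ xs) (y ∷ ys))) ≡ apart x y (𝟙 (does (disjoint? xs ys)))
  byCases (yes x≡y) =
    trans (cong 𝟙 (dec-false (disjoint? (x ∷ xs) (y ∷ ys))
                             (λ where (x∉ ∷ _) → x∉ (here x≡y))))
          (sym (apart-≡ x≡y))
  byCases (no  x≢y) =
    trans (cong 𝟙 (does-⇔ (disjoint-∷⇔ x~y xs-above ys-above x≢y)
                          (disjoint? (x ∷ xs) (y ∷ ys)) (disjoint? xs ys)))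
          (sym (apart-≢ x≢y))

disjoint-avoids : ∀ {n} p (w : Walk n) q v → level p ≡ level q →
  𝟙 (does (disjoint? (vertsFrom p w) (vertsFrom q v))) ≡ avoids p w q v
disjoint-avoids p []      q []      _   = refl
disjoint-avoids p (b ∷ w) q (c ∷ v) p~q =
  trans (disjoint-∷ p′~q′ (vertsFrom-above (move b p) w) (vertsFrom-above (move c q) v))
        (cong (apart (move b p) (move c q)) (disjoint-avoids (move b p) w (move c q) v p′~q′))
  where
  p′~q′ : level (move b p) ≡ level (move c q)
  p′~q′ = trans (level-move b p) (trans (cong suc p~q) (sym (level-move c q)))

meetFree : ℕ → Point → Point → ℕ
meetFree n p q = ∑ (allWalks n) (λ w → ∑ (allWalks n) (λ v → avoids p w q v))

favourable≡meetFree : ∀ n → favourable n ≡ meetFree n (0 , 0) (0 , 0)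
favourable≡meetFree n = begin
  favourable n
    ≡⟨ length-filter _ (allPairs n) ⟩
  ∑ (allPairs n) (λ wv → 𝟙 (does (noCommonVertex? (proj₁ wv) (proj₂ wv))))
    ≡⟨ ∑-cartesianProduct W W _ ⟩
  ∑ W (λ w → ∑ W (λ v → 𝟙 (does (noCommonVertex? w v))))
    ≡⟨ ∑-cong W (λ w → ∑-cong W (λ v → disjoint-avoids (0 , 0) w (0 , 0) v refl)) ⟩
  meetFree n (0 , 0) (0 , 0) ∎
  where W = allWalks n

meetFree₀ : ℕ → Point → Point → ℕ
meetFree₀ n p q = apart p q (meetFree n p q)

meetFree₀-comm : ∀ n p q → meetFree₀ n p q ≡ meetFree₀ n q p
meetFree₀-comm n p q = trans apart-comm (cong (apart q p) (begin
  meetFree n p q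
    ≡⟨ ∑-comm (allWalks n) (allWalks n) _ ⟩
  ∑ (allWalks n) (λ v → ∑ (allWalks n) (λ w → avoids p w q v))
    ≡⟨ ∑-cong (allWalks n) (λ v → ∑-cong (allWalks n) (λ w → avoids-comm p w q v)) ⟩
  meetFree n q p ∎))

meetFree-suc : ∀ n p q → meetFree (suc n) p q ≡
  (meetFree₀ n (move true p) (move true q) + meetFree₀ n (move true p) (move false q)) +
  (meetFree₀ n (move false p) (move true q) + meetFree₀ n (move false p) (move false q))
meetFree-suc n p q =
  trans (∑-allWalks-suc n (λ w → ∑ (allWalks (suc n)) (avoids p w q)))
        (cong₂ _+_ (firstSteps true) (firstSteps false))
  where
  W = allWalks n

  after : Bool → Bool → Walk n → Walk n → ℕ
  after b c w v = avoids p (b ∷ w) q (c ∷ v)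

  firstStep : ∀ b c → ∑ W (λ w → ∑ W (after b c w)) ≡ meetFree₀ n (move b p) (move c q)
  firstStep b c = trans (∑-cong W (λ w → ∑-apart (move b p) (move c q) W _))
                        (∑-apart (move b p) (move c q) W _)

  firstSteps : ∀ b → ∑ W (λ w → ∑ (allWalks (suc n)) (avoids p (b ∷ w) q)) ≡
    meetFree₀ n (move b p) (move true q) + meetFree₀ n (move b p) (move false q)
  firstSteps b = begin
    ∑ W (λ w → ∑ (allWalks (suc n)) (avoids p (b ∷ w) q))
      ≡⟨ ∑-cong W (λ w → ∑-allWalks-suc n (avoids p (b ∷ w) q)) ⟩
    ∑ W (λ w → ∑ W (after b true w) + ∑ W (after b false w))
      ≡⟨ ∑-+ W _ _ ⟩
    ∑ W (λ w → ∑ W (after b true w)) + ∑ W (λ w → ∑ W (after b false w))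
      ≡⟨ cong₂ _+_ (firstStep b true) (firstStep b false) ⟩
    meetFree₀ n (move b p) (move true q) + meetFree₀ n (move b p) (move false q) ∎

meetFree₀-+-suc : ∀ n a b x y d →
  meetFree₀ n (a , y + suc d) (x + suc d , b) ≡ meetFree₀ n (a , suc (y + d)) (suc (x + d) , b)
meetFree₀-+-suc n a b x y d =
  cong₂ (λ s t → meetFree₀ n (a , s) (t , b)) (+-suc y d) (+-suc x d)

-- At gap 0 the walks collide and both sides vanish; this lets the gap-lowering step recurse uniformly.
meetFree₀-gap : ∀ n x y g → meetFree₀ n (x , y + g) (x + g , y) ≡ oddCentralSum n g
meetFree-gap  : ∀ n x y d → meetFree n (x , y + suc d) (x + suc d , y) ≡ oddCentralSum n (suc d)

meetFree₀-gap n x y zero    = apart-≡ (cong₂ _,_ (sym (+-identityʳ x)) (+-identityʳ y))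
meetFree₀-gap n x y (suc d) =
  trans (apart-≢ (λ p≡q → m+1+n≢m x (sym (cong proj₁ p≡q)))) (meetFree-gap n x y d)

meetFree-gap zero    x y d = sym (oddCentralSum-zero d)
meetFree-gap (suc n) x y d = begin
  meetFree (suc n) (x , y + suc d) (x + suc d , y)
    ≡⟨ meetFree-suc n _ _ ⟩
  (meetFree₀ n (x , suc (y + suc d)) (x + suc d , suc y) +
   meetFree₀ n (x , suc (y + suc d)) (suc (x + suc d) , y)) +
  (meetFree₀ n (suc x , y + suc d) (x + suc d , suc y) +
   meetFree₀ n (suc x , y + suc d) (suc (x + suc d) , y))
    ≡⟨ cong₂ _+_ (cong₂ _+_ (meetFree₀-gap n x (suc y) (suc d)) raise)
                 (cong₂ _+_ lower (meetFree₀-gap n (suc x) y (suc d))) ⟩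
  (s (suc d) + s (2 + d)) + (s d + s (suc d))
    ≡⟨ regroup (s d) (s (suc d)) (s (2 + d)) ⟩
  s d + 2 * s (suc d) + s (2 + d)
    ≡⟨ oddCentralSum-suc n d ⟨
  oddCentralSum (suc n) (suc d) ∎
  where
  s = oddCentralSum n

  raise : meetFree₀ n (x , suc (y + suc d)) (suc (x + suc d) , y) ≡ s (2 + d)
  raise = trans (sym (meetFree₀-+-suc n x y x y (suc d))) (meetFree₀-gap n x y (2 + d))

  lower : meetFree₀ n (suc x , y + suc d) (x + suc d , suc y) ≡ s d
  lower = trans (meetFree₀-+-suc n (suc x) (suc y) x y d) (meetFree₀-gap n (suc x) (suc y) d)

  regroup : ∀ a b c → (b + c) + (a + b) ≡ a + 2 * b + c
  regroup = solve-∀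

meetFree-origin : ∀ n → meetFree n (0 , 0) (0 , 0) ≡ (2 * n) C n
meetFree-origin zero    = refl
meetFree-origin (suc n) = begin
  meetFree (suc n) (0 , 0) (0 , 0)
    ≡⟨ meetFree-suc n (0 , 0) (0 , 0) ⟩
  (meetFree₀ n (0 , 1) (0 , 1) + meetFree₀ n (0 , 1) (1 , 0)) +
  (meetFree₀ n (1 , 0) (0 , 1) + meetFree₀ n (1 , 0) (1 , 0))
    ≡⟨ cong₂ _+_ (cong₂ _+_ (apart-≡ refl) (meetFree₀-gap n 0 0 1))
                 (cong₂ _+_ (trans (meetFree₀-comm n (1 , 0) (0 , 1)) (meetFree₀-gap n 0 0 1))
                            (apart-≡ refl)) ⟩
  (0 + c) + (c + 0) ≡⟨ cong (_+_ c) (+-identityʳ c) ⟩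
  c + c             ≡⟨ centralBinomial-suc n ⟨
  (2 * suc n) C suc n ∎
  where c = oddCentral n 0

corollary2 : (n : ℕ) →
    probNoCommonVertex n ≡ _/_ (+ ((2 * n) C n)) (4 ^ n) {{m^n≢0 4 n}}
corollary2 n = cong (λ k → _/_ (+ k) (4 ^ n) {{m^n≢0 4 n}})
  (trans (favourable≡meetFree n) (meetFree-origin n))
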